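{- Let $v\in I(d)$. (1) If $C\subseteq D$ are $v$-chains (i.e. $C$ is a subsequence of $D$), then for every element $\alpha$ of $C$, the $O$-depth of $\alpha$ in $C$ is at most the $O$-depth of $\alpha$ in $D$. (2) If $C$ is an initial segment of the $v$-chain $D$, then for every element $\alpha$ of $C$ the $O$-depths of $\alpha$ in $C$ and in $D$ are equal.
   Context: $k^*:=2d+1-k$; $I(d)$ is the set of $d$-element subsets of $\{1,\dots,2d\}$ containing exactly one of $k,k^*$ for each $k$ and having an even number of entries exceeding $d$. $R_v=\{(r,c):r\notin v,\ c\in v\}$, $N_v=\{(r,c)\in R_v:r>c\}$, $ON_v=\{(r,c)\in N_v:r<c^*\}$. $(R,C)>(r,c)$ means $R>r$ and $C<c$; a $v$-chain is a sequence $\alpha_1>\dots>\alpha_\ell$ in $ON_v$. For $\alpha=(r,c)$: $p_v(\alpha)=(c^*,c)$, $p_h(\alpha)=(r,r^*)$, $\alpha^\#=(c^*,r^*)$. Consecutive $\alpha_j=(r_j,c_j)$, $\alpha_{j+1}=(r_{j+1},c_{j+1})$ are connected if $r_j\le c_{j+1}^*$ and $r_{j+1}>r_j^*$; connected components are classes of the generated equivalence relation. Type: in a connected $v$-chain $\alpha_1>\dots>\alpha_\ell$, $\alpha_j$ has type V if $j\ne\ell$ or $\ell$ is even; type H if $j=\ell$ is odd and $p_h(\alpha_\ell)\in N_v$ (i.e. $r_\ell>r_\ell^*$); type S if $j=\ell$ is odd and $p_h(\alpha_\ell)\notin N_v$. In a general $v$-chain, an element's type is its type in its connected component. For $\alpha$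 in $C$, $S_{C,\alpha}=\{p_v(\alpha)\}$, $\{p_v(\alpha),p_h(\alpha)\}$, or $\{\alpha,\alpha^\#\}$ according as its type is V, H, or S, and $S_C=\bigcup_{\alpha\in C}S_{C,\alpha}\subseteq N_v$; also $q_{C,\alpha}=p_v(\alpha)$ if $\alpha$ has type V or H, and $q_{C,\alpha}=\alpha$ if type S. For a monomial $T$ in $N_v$ and $x\in T$, the depth of $x$ in $T$ is the largest $t$ such that there are elements $\beta_1>\dots>\beta_t=x$ of $T$. The $O$-depth of $\alpha$ in a $v$-chain $C$ is the depth of $q_{C,\alpha}$ in $S_C$. -}

module Defs where

open import Data.Nat using (ℕ; zero; suc; _+_; _*_; _∸_; _≤_; _<_; _>_; _≟_; _<?_)
open import Data.Nat.Divisibility using (_∣_)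
open import Data.Bool using (Bool; true; false; not; _∧_; if_then_else_)
open import Data.List using (List; []; _∷_; _++_; length; filter; concatMap; map)
open import Data.List.Membership.Propositional using (_∈_; _∉_)
open import Data.List.Membership.DecPropositional _≟_ using (_∈?_)
open import Data.List.Relation.Unary.All using (All)
open import Data.List.Relation.Unary.Unique.Propositional using (Unique)
open import Data.List.Relation.Unary.Linked using (Linked)
open import Data.Product using (Σ; _×_; _,_)
open import Data.Sum using (_⊎_)
open import Relation.Nullary using (does)
open import Relation.Binary.PropositionalEquality using (_≡_)

-- Positions are pairs (row , column) of natural numbers.
Pos : Set
Pos = ℕ × ℕ

star : ℕ → ℕ → ℕ
star d k = (2 * d + 1) ∸ k

InRange : ℕ → ℕ → Set
InRange d k = 1 ≤ k × k ≤ 2 * d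

InI : ℕ → List ℕ → Set
InI d v =
  Unique v × All (InRange d) v × length v ≡ d ×
  (∀ k → InRange d k → (k ∈ v × star d k ∉ v) ⊎ (k ∉ v × star d k ∈ v)) ×
  (2 ∣ length (filter (d <?_) v))

InR : ℕ → List ℕ → Pos → Set
InR d v (r , c) = InRange d r × InRange d c × r ∉ v × c ∈ v

InN : ℕ → List ℕ → Pos → Set
InN d v (r , c) = InR d v (r , c) × c < r

InON : ℕ → List ℕ → Pos → Set
InON d v (r , c) = InN d v (r , c) × r < star d c

inRangeᵇ : ℕ → ℕ → Bool
inRangeᵇ d k = does (0 <? k) ∧ does (k <? suc (2 * d))

inNᵇ : ℕ → List ℕ → Pos → Bool
inNᵇ d v (r , c) =
  inRangeᵇ d r ∧ inRangeᵇ d c ∧ not (does (r ∈? v)) ∧ does (c ∈? v) ∧ does (c <? r)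

_≻_ : Pos → Pos → Set
(R , C) ≻ (r , c) = r < R × C < c

VChain : ℕ → List ℕ → List Pos → Set
VChain d v C = All (InON d v) C × Linked _≻_ C

pv : ℕ → Pos → Pos
pv d (r , c) = (star d c , c)

ph : ℕ → Pos → Pos
ph d (r , c) = (r , star d r)

sharp : ℕ → Pos → Pos
sharp d (r , c) = (star d c , star d r)

connᵇ : ℕ → Pos → Pos → Bool
connᵇ d (r₁ , c₁) (r₂ , c₂) = does (r₁ <? suc (star d c₂)) ∧ does (star d r₁ <? r₂)

components : ℕ → List Pos → List (List Pos)
components d [] = []
components d (x ∷ xs) with components d xs
... | [] = (x ∷ []) ∷ []
... | [] ∷ rs = (x ∷ []) ∷ rs
... | (y ∷ ys) ∷ rs =
  if connᵇ d x y then (x ∷ y ∷ ys) ∷ rs else (x ∷ []) ∷ (y ∷ ys) ∷ rs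

data Ty : Set where
  V H S : Ty

evenᵇ : ℕ → Bool
evenᵇ zero = true
evenᵇ (suc n) = not (evenᵇ n)

typeConnected : ℕ → List ℕ → ℕ → List Pos → List (Pos × Ty)
typeConnected d v ℓ [] = []
typeConnected d v ℓ (x ∷ []) =
  (x , (if evenᵇ ℓ then V else (if inNᵇ d v (ph d x) then H else S))) ∷ []
typeConnected d v ℓ (x ∷ y ∷ ys) = (x , V) ∷ typeConnected d v ℓ (y ∷ ys)

annotate : ℕ → List ℕ → List Pos → List (Pos × Ty)
annotate d v C = concatMap (λ K → typeConnected d v (length K) K) (components d C)

Sα : ℕ → Pos → Ty → List Pos
Sα d α V = pv d α ∷ []
Sα d α H = pv d α ∷ ph d α ∷ []
Sα d α S = α ∷ sharp d α ∷ []

-- S_C (as a list; only membership matters)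
SC : ℕ → List ℕ → List Pos → List Pos
SC d v C = concatMap (λ { (α , τ) → Sα d α τ }) (annotate d v C)

qα : ℕ → Pos → Ty → Pos
qα d α V = pv d α
qα d α H = pv d α
qα d α S = α

ChainTo : List Pos → Pos → ℕ → Set
ChainTo T x t =
  Σ (List Pos) λ bs → All (_∈ T) (bs ++ x ∷ []) × Linked _≻_ (bs ++ x ∷ []) ×
                      length (bs ++ x ∷ []) ≡ t

Depth : List Pos → Pos → ℕ → Set
Depth T x t = x ∈ T × ChainTo T x t × (∀ s → ChainTo T x s → s ≤ t)

ODepth : ℕ → List ℕ → List Pos → Pos → ℕ → Set
ODepth d v C α t =
  Σ Ty λ τ → (α , τ) ∈ annotate d v C × Depth (SC d v C) (qα d α τ) t

-- Write C = P ++ α ∷ R and let c be the column of α.  Computing components and types from left to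
-- right, the annotation of C agrees on P with the annotation of P alone, except that the last
-- element of P may become of type V when it is connected to α, which changes nothing to the left
-- of column c.  The elements of S_C above q_{C,α} are exactly the members of the sets S_{C,β},
-- β ∈ P, lying left of column c: p_v(β) (or β itself if β has type S), together with p_h(β) when
-- β has type H and r_β* < c.  They form a single chain ending at q_{C,α}, so the O-depth of α is
-- |P| + #{β ∈ P of type H in P with r_β* < c} + 1.  This depends on P only, which gives (2); and
-- deleting one element of P lowers |P| by one while raising the H-count by at most one, which
-- gives (1).

module Submission where

open import Defs
open import Algebra.Properties.CommutativeSemigroup using (x∙yz≈y∙xz)
open import Data.Bool using (Bool; true; false; not; _∧_; if_then_else_)
open import Data.Bool.Properties using (not-involutive; ∧-conicalʳ; T-≡)
open import Data.List using (List; []; _∷_; _++_; length; map; concatMap)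
open import Data.List.Properties using (∷-injectiveˡ; ++-assoc; map-++; length-++; length-map; length-++-sucʳ)
open import Data.List.Membership.Propositional using (_∈_; _∉_; find; lose)
open import Data.List.Membership.Propositional.Properties
  using (∈-∃++; ∈-++⁺ˡ; ∈-++⁺ʳ; ∈-++⁻; ∈-map⁺; ∈-concatMap⁺; ∈-concatMap⁻)
open import Data.List.Relation.Binary.Sublist.Propositional using (_⊆_; []; _∷_; _∷ʳ_)
open import Data.List.Relation.Unary.All as All using (All; []; _∷_)
import Data.List.Relation.Unary.All.Properties as All
open import Data.List.Relation.Unary.AllPairs using (AllPairs; []; _∷_)
open import Data.List.Relation.Unary.Any using (here; there)
open import Data.List.Relation.Unary.Linked as Linked using (Linked; []; [-]; _∷_)
open import Data.List.Relation.Unary.Linked.Properties using (Linked⇒All; Linked⇒AllPairs; map⁻)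
open import Data.Nat
open import Data.Nat.ListAction using (sum)
open import Data.Nat.Properties
open import Data.List.Membership.DecPropositional _≟_ using (_∈?_)
open import Data.Product using (Σ; ∃; ∃₂; _×_; _,_; proj₁; proj₂)
open import Data.Sum using (_⊎_; inj₁; inj₂)
open import Function using (_on_)
open import Function.Bundles using (Equivalence)
open import Level using (0ℓ)
open import Relation.Binary.Core using (Rel)
open import Relation.Binary.PropositionalEquality
open import Relation.Nullary using (¬_; yes; no; does; contradiction; ofʸ; ofⁿ)
open import Relation.Nullary.Decidable using (dec-true; dec-false)

≻-trans : {a b c : Pos} → a ≻ b → b ≻ c → a ≻ c
≻-trans (r₂<r₁ , c₁<c₂) (r₃<r₂ , c₂<c₃) = <-trans r₃<r₂ r₂<r₁ , <-trans c₁<c₂ c₂<c₃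

≻-irrefl : {a : Pos} → ¬ a ≻ a
≻-irrefl (r<r , _) = <-irrefl refl r<r

module _ {A : Set} {R : Rel A 0ℓ} where

  Linked-++⁻ˡ : ∀ xs {ys} → Linked R (xs ++ ys) → Linked R xs
  Linked-++⁻ˡ []           _           = []
  Linked-++⁻ˡ (x ∷ [])     _           = [-]
  Linked-++⁻ˡ (x ∷ y ∷ xs) (Rxy ∷ lnk) = Rxy ∷ Linked-++⁻ˡ (y ∷ xs) lnk

  Linked-++⁻ʳ : ∀ xs {ys} → Linked R (xs ++ ys) → Linked R ys
  Linked-++⁻ʳ []       lnk = lnk
  Linked-++⁻ʳ (x ∷ xs) lnk = Linked-++⁻ʳ xs (Linked.tail lnk)

⊆-middle : ∀ {A : Set} (P : List A) {α R D} → P ++ α ∷ R ⊆ D →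
  Σ (List A) λ P′ → Σ (List A) λ R′ → D ≡ P′ ++ α ∷ R′ × P ⊆ P′
⊆-middle []      (refl ∷ _)   = [] , _ , refl , []
⊆-middle P       (y ∷ʳ sub)   =
  let P′ , R′ , eq , P⊆ = ⊆-middle P sub in y ∷ P′ , R′ , cong (y ∷_) eq , y ∷ʳ P⊆
⊆-middle (p ∷ P) (refl ∷ sub) =
  let P′ , R′ , eq , P⊆ = ⊆-middle P sub in p ∷ P′ , R′ , cong (p ∷_) eq , refl ∷ P⊆

VChain-++⁻ˡ : ∀ {d v} C {E} → VChain d v (C ++ E) → VChain d v C
VChain-++⁻ˡ C (allON , lnk) = All.++⁻ˡ C allON , Linked-++⁻ˡ C lnk

above-∷ : ∀ {x xs} → Linked _≻_ (x ∷ xs) → All (x ≻_) xs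
above-∷ [-]       = []
above-∷ (x≻ ∷ lnk) = Linked⇒All ≻-trans x≻ lnk

above-middle : ∀ P {α R} → Linked _≻_ (P ++ α ∷ R) → All (_≻ α) P
above-middle P lnk = go P (Linked⇒AllPairs ≻-trans lnk)
  where
  go : ∀ P {α R} → AllPairs _≻_ (P ++ α ∷ R) → All (_≻ α) P
  go []      _          = []
  go (p ∷ P) (p≻ ∷ ps) = All.lookup p≻ (∈-++⁺ʳ P (here refl)) ∷ go P ps

below-middle : ∀ P {α R} → Linked _≻_ (P ++ α ∷ R) → All (α ≻_) R
below-middle P lnk = above-∷ (Linked-++⁻ʳ P lnk)

private
  drop-above : ∀ {l L M} → All (_∈ l ∷ L) M → All (l ≻_) M → All (_∈ L) M
  drop-above []                 []          = []
  drop-above (here refl ∷ _)    (l≻l ∷ _)   = contradiction l≻l ≻-irrefl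
  drop-above (there m∈ ∷ m∈s)   (_ ∷ l≻s)   = m∈ ∷ drop-above m∈s l≻s

descending-⊆⇒length-≤ : ∀ {L M} → Linked _≻_ L → Linked _≻_ M → All (_∈ L) M → length M ≤ length L
descending-⊆⇒length-≤ {L}     {[]}    _ _ _ = z≤n
descending-⊆⇒length-≤ {l ∷ L} {m ∷ M} lnkL lnkM (here refl ∷ M∈) =
  s≤s (descending-⊆⇒length-≤ (Linked.tail lnkL) (Linked.tail lnkM) (drop-above M∈ (above-∷ lnkM)))
descending-⊆⇒length-≤ {l ∷ L} {m ∷ M} lnkL lnkM (there m∈L ∷ M∈) =
  m≤n⇒m≤1+n (descending-⊆⇒length-≤ (Linked.tail lnkL) lnkM (drop-above (there m∈L ∷ M∈) (l≻m ∷ l≻M)))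
  where
  l≻m = All.lookup (above-∷ lnkL) m∈L
  l≻M = All.map (≻-trans l≻m) (above-∷ lnkM)

saturated-chain⇒Depth : ∀ {T x} bs → All (_∈ T) (bs ++ x ∷ []) → Linked _≻_ (bs ++ x ∷ []) →
  (∀ {y} → y ∈ T → y ≻ x → y ∈ bs) → Depth T x (length (bs ++ x ∷ []))
saturated-chain⇒Depth {T} {x} bs bs∈T lnk saturated =
  All.lookup bs∈T (∈-++⁺ʳ bs (here refl)) , (bs , bs∈T , lnk , refl) , maximal
  where
  maximal : ∀ s → ChainTo T x s → s ≤ length (bs ++ x ∷ [])
  maximal s (cs , cs∈T , lnk′ , refl) = descending-⊆⇒length-≤ lnk lnk′ (All.tabulate inChain)
    where
    inChain : ∀ {y} → y ∈ cs ++ x ∷ [] → y ∈ bs ++ x ∷ []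
    inChain y∈ with ∈-++⁻ cs y∈
    ... | inj₁ y∈cs       = ∈-++⁺ˡ (saturated (All.lookup cs∈T y∈) (All.lookup (above-middle cs lnk′) y∈cs))
    ... | inj₂ (here refl) = ∈-++⁺ʳ bs (here refl)

module StarArithmetic (d : ℕ) where

  N : ℕ
  N = 2 * d + 1

  ≤2d⇒≤N : ∀ {k} → k ≤ 2 * d → k ≤ N
  ≤2d⇒≤N {k} k≤ = ≤-trans k≤ (m≤m+n (2 * d) 1)

  ≤2d⇒<N : ∀ {k} → k ≤ 2 * d → k < N
  ≤2d⇒<N {k} k≤ = subst (k <_) (+-comm 1 (2 * d)) (s≤s k≤)

  <star⇒+<N : ∀ {a b} → b ≤ N → a < star d b → a + b < N
  <star⇒+<N {a} b≤N a< = m≤o∸n⇒m+n≤o (suc a) b≤N a<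

  +<N⇒<star : ∀ {a b} → a + b < N → a < star d b
  +<N⇒<star {a} a+b< = m+n≤o⇒m≤o∸n (suc a) a+b<

  ≤star⇒+≤N : ∀ {a b} → b ≤ N → a ≤ star d b → a + b ≤ N
  ≤star⇒+≤N {a} b≤N a≤ = m≤o∸n⇒m+n≤o a b≤N a≤

  +≤N⇒≤star : ∀ {a b} → a + b ≤ N → a ≤ star d b
  +≤N⇒≤star {a} a+b≤ = m+n≤o⇒m≤o∸n a a+b≤

  star<⇒N<+ : ∀ {a b} → star d a < b → N < a + b
  star<⇒N<+ {a} {b} a*<b = ≰⇒> λ a+b≤N → <⇒≱ a*<b (+≤N⇒≤star (subst (_≤ N) (+-comm a b) a+b≤N))

  N<+⇒star< : ∀ {a b} → a ≤ N → N < a + b → star d a < b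
  N<+⇒star< {a} {b} a≤N N<a+b = ≰⇒> λ b≤a* → <⇒≱ N<a+b (subst (_≤ N) (+-comm b a) (≤star⇒+≤N a≤N b≤a*))

  star-antitone : ∀ {a b} → a ≤ b → star d b ≤ star d a
  star-antitone = ∸-monoʳ-≤ N

  star-InRange : ∀ {k} → InRange d k → InRange d (star d k)
  star-InRange {k} (1≤k , k≤2d) =
    m<n⇒0<n∸m (≤2d⇒<N k≤2d) , subst (star d k ≤_) (m+n∸n≡m (2 * d) 1) (star-antitone 1≤k)

  record ONBounds (r c : ℕ) : Set where
    field
      c<r   : c < r
      r+c<N : r + c < N
      r≤2d  : r ≤ 2 * d
      c≤2d  : c ≤ 2 * d

  c<star-r : ∀ {r c} → ONBounds r c → c < star d r
  c<star-r {r} {c} b = +<N⇒<star (subst (_< N) (+-comm r c) (ONBounds.r+c<N b))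

  InON⇒ONBounds : ∀ {v r c} → InON d v (r , c) → ONBounds r c
  InON⇒ONBounds (((r∈ , c∈ , _) , c<r) , r<c*) = record
    { c<r = c<r ; r+c<N = <star⇒+<N (≤2d⇒≤N (proj₂ c∈)) r<c* ; r≤2d = proj₂ r∈ ; c≤2d = proj₂ c∈ }

  Connected : Pos → Pos → Set
  Connected (r₁ , _) (r₂ , c₂) = r₁ ≤ star d c₂ × star d r₁ < r₂

  connᵇ≡true⇒Connected : ∀ a b → connᵇ d a b ≡ true → Connected a b
  connᵇ≡true⇒Connected (r₁ , _) (r₂ , c₂)
    with r₁ <ᵇ suc (star d c₂) | <ᵇ-reflects-< r₁ (suc (star d c₂)) | star d r₁ <ᵇ r₂ | <ᵇ-reflects-< (star d r₁) r₂
  ... | true  | ofʸ r₁≤ | true  | ofʸ r₁*< = λ _ → s≤s⁻¹ r₁≤ , r₁*<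
  ... | true  | _       | false | _        = λ ()
  ... | false | _       | _     | _        = λ ()

  Connected⇒connᵇ≡true : ∀ a b → Connected a b → connᵇ d a b ≡ true
  Connected⇒connᵇ≡true (r₁ , _) (r₂ , c₂) (r₁≤ , r₁*<) =
    cong₂ _∧_ (dec-true (r₁ <? suc (star d c₂)) (s≤s r₁≤)) (dec-true (star d r₁ <? r₂) r₁*<)

  connᵇ≡false⇒¬Connected : ∀ a b → connᵇ d a b ≡ false → ¬ Connected a b
  connᵇ≡false⇒¬Connected a b conn connected =
    contradiction (trans (sym conn) (Connected⇒connᵇ≡true a b connected)) λ ()

module Annotation (d : ℕ) (v : List ℕ) where

  oddEndType : Pos → Ty
  oddEndType x = if inNᵇ d v (ph d x) then H else S

  -- The flag records whether the connected run ending at x has even length.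
  endType : Bool → Pos → Ty
  endType true  _ = V
  endType false x = oddEndType x

  scanFrom : Bool → Pos → List Pos → List (Pos × Ty)
  scanFrom e x []       = (x , endType e x) ∷ []
  scanFrom e x (y ∷ ys) =
    if connᵇ d x y then (x , V) ∷ scanFrom (not e) y ys else (x , endType e x) ∷ scanFrom false y ys

  scan : Bool → List Pos → List (Pos × Ty)
  scan e []       = []
  scan e (x ∷ xs) = scanFrom e x xs

  typeComponent : List Pos → List (Pos × Ty)
  typeComponent K = typeConnected d v (length K) K

  typeConnected-parity : ∀ ℓ ℓ′ K → evenᵇ ℓ ≡ evenᵇ ℓ′ → typeConnected d v ℓ K ≡ typeConnected d v ℓ′ K
  typeConnected-parity ℓ ℓ′ []           _  = refl
  typeConnected-parity ℓ ℓ′ (x ∷ [])     eq rewrite eq = refl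
  typeConnected-parity ℓ ℓ′ (x ∷ y ∷ K)  eq = cong ((x , V) ∷_) (typeConnected-parity ℓ ℓ′ (y ∷ K) eq)

  bit : Bool → ℕ
  bit true  = 1
  bit false = 0

  components-∷ : ∀ y {y₂ ys K cs} → components d (y₂ ∷ ys) ≡ (y₂ ∷ K) ∷ cs →
    components d (y ∷ y₂ ∷ ys) ≡
      (if connᵇ d y y₂ then (y ∷ y₂ ∷ K) ∷ cs else (y ∷ []) ∷ (y₂ ∷ K) ∷ cs)
  components-∷ y eq rewrite eq = refl

  -- The flag of scanFrom counts as one extra element at the start of the first run.
  scanFrom≡typeComponents : ∀ y ys → ∃₂ λ K cs → components d (y ∷ ys) ≡ (y ∷ K) ∷ cs ×
    (∀ e → scanFrom e y ys ≡ typeConnected d v (bit e + length (y ∷ K)) (y ∷ K) ++ concatMap typeComponent cs)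
  scanFrom≡typeComponents y [] = [] , [] , refl , λ { true → refl ; false → refl }
  scanFrom≡typeComponents y (y₂ ∷ ys) with scanFrom≡typeComponents y₂ ys | connᵇ d y y₂ in conn
  ... | K , cs , comps , scanEq | true =
    y₂ ∷ K , cs ,
    trans (components-∷ y {ys = ys} comps) (cong (λ b → if b then _ else (y ∷ []) ∷ (y₂ ∷ K) ∷ cs) conn) ,
    λ e → cong ((y , V) ∷_) (trans (scanEq (not e)) (cong (_++ _) (typeConnected-parity _ _ (y₂ ∷ K) (flip e))))
    where
    flip : ∀ e → evenᵇ (bit (not e) + suc (length K)) ≡ evenᵇ (bit e + suc (suc (length K)))
    flip true  = sym (not-involutive _)
    flip false = refl
  ... | K , cs , comps , scanEq | false =
    [] , (y₂ ∷ K) ∷ cs ,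
    trans (components-∷ y {ys = ys} comps) (cong (λ b → if b then (y ∷ y₂ ∷ K) ∷ cs else _) conn) ,
    λ { true → cong ((y , V) ∷_) (scanEq false) ; false → cong ((y , oddEndType y) ∷_) (scanEq false) }

  annotate≡scan : ∀ C → annotate d v C ≡ scan false C
  annotate≡scan []       = refl
  annotate≡scan (y ∷ ys) with scanFrom≡typeComponents y ys
  ... | K , cs , comps , scanEq rewrite comps = sym (scanEq false)

  -- Counts p_h(β) = (r , r*) when it belongs to S_{C,β} and lies left of column c.
  hBonus : ℕ → Pos × Ty → ℕ
  hBonus c ((r , _) , H) = if star d r <ᵇ c then 1 else 0
  hBonus c (_ , V)       = 0
  hBonus c (_ , S)       = 0

  hBonuses : ℕ → List (Pos × Ty) → ℕ
  hBonuses c es = sum (map (hBonus c) es)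

  hBonus≤1 : ∀ c e → hBonus c e ≤ 1
  hBonus≤1 c ((r , _) , H) with star d r <ᵇ c
  ... | true  = ≤-refl
  ... | false = z≤n
  hBonus≤1 c (_ , V) = z≤n
  hBonus≤1 c (_ , S) = z≤n

  private
    bonus+≤ : ∀ h′ {h m n} → h ≤ 1 → m ≤ n → h + m ≤ suc (h′ + n)
    bonus+≤ h′ {n = n} h≤1 m≤n = ≤-trans (+-mono-≤ h≤1 m≤n) (s≤s (m≤n+m n h′))

    single-bonus≤ : ∀ c e {n} → hBonuses c (e ∷ []) ≤ suc n
    single-bonus≤ c e = ≤-trans (+-monoˡ-≤ 0 (hBonus≤1 c e)) (s≤s z≤n)

    +-≤-suc : ∀ h {m n} → m ≤ suc n → h + m ≤ suc (h + n)
    +-≤-suc h {m} {n} m≤ = ≤-trans (+-monoʳ-≤ h m≤) (≤-reflexive (+-suc h n))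

  hBonuses-flag : ∀ c e e′ x xs → hBonuses c (scanFrom e x xs) ≤ suc (hBonuses c (scanFrom e′ x xs))
  hBonuses-flag c e e′ x [] = single-bonus≤ c (x , endType e x)
  hBonuses-flag c e e′ x (y ∷ ys) with connᵇ d x y
  ... | true  = hBonuses-flag c (not e) (not e′) y ys
  ... | false = bonus+≤ (hBonus c (x , endType e′ x)) (hBonus≤1 c (x , endType e x)) ≤-refl

  hBonuses-tail : ∀ c e x y ys → Σ Bool λ e′ → hBonuses c (scanFrom e′ y ys) ≤ hBonuses c (scanFrom e x (y ∷ ys))
  hBonuses-tail c e x y ys with connᵇ d x y
  ... | true  = not e , ≤-refl
  ... | false = false , m≤n+m _ _

  hBonuses-delete-head : ∀ c e x q Q → hBonuses c (scanFrom e q Q) ≤ suc (hBonuses c (scanFrom e x (q ∷ Q)))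
  hBonuses-delete-head c e x q Q with connᵇ d x q
  ... | true  = hBonuses-flag c e (not e) q Q
  ... | false = ≤-trans (hBonuses-flag c e false q Q) (s≤s (m≤n+m _ (hBonus c (x , endType e x))))

  hBonuses-delete-after : ∀ c e p P x Q →
    hBonuses c (scanFrom e p (P ++ Q)) ≤ suc (hBonuses c (scanFrom e p (P ++ x ∷ Q)))
  hBonuses-delete-after c e p [] x [] = single-bonus≤ c (p , endType e p)
  hBonuses-delete-after c e p [] x (q ∷ Q) with connᵇ d p q
  ... | true =
    let e₁ , q≤x = hBonuses-tail c e p x (q ∷ Q)
        e₂ , x≤p = hBonuses-tail c e₁ x q Q
    in ≤-trans (hBonuses-flag c (not e) e₂ q Q) (s≤s (≤-trans x≤p q≤x))
  ... | false with connᵇ d p x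
  ...   | false = +-≤-suc (hBonus c (p , endType e p)) (hBonuses-delete-head c false x q Q)
  ...   | true  = p-connected-to-x e
    where
    p-connected-to-x : ∀ e → hBonus c (p , endType e p) + hBonuses c (scanFrom false q Q)
                               ≤ suc (hBonuses c (scanFrom (not e) x (q ∷ Q)))
    p-connected-to-x true = hBonuses-delete-head c false x q Q
    p-connected-to-x false with connᵇ d x q
    ... | true  = +-monoˡ-≤ _ (hBonus≤1 c (p , oddEndType p))
    ... | false = +-monoˡ-≤ _ (hBonus≤1 c (p , oddEndType p))
  hBonuses-delete-after c e p (p′ ∷ P) x Q with connᵇ d p p′
  ... | true  = hBonuses-delete-after c (not e) p′ P x Q
  ... | false = +-≤-suc (hBonus c (p , endType e p)) (hBonuses-delete-after c false p′ P x Q)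

  hBonuses-delete : ∀ c e P x Q → hBonuses c (scan e (P ++ Q)) ≤ suc (hBonuses c (scan e (P ++ x ∷ Q)))
  hBonuses-delete c e []      x []      = z≤n
  hBonuses-delete c e []      x (q ∷ Q) = hBonuses-delete-head c e x q Q
  hBonuses-delete c e (p ∷ P) x Q       = hBonuses-delete-after c e p P x Q

  weight : ℕ → List Pos → ℕ
  weight c P = length P + hBonuses c (scan false P)

  weight-delete : ∀ c A x B → weight c (A ++ B) ≤ weight c (A ++ x ∷ B)
  weight-delete c A x B rewrite length-++-sucʳ A x B =
    +-≤-suc (length (A ++ B)) (hBonuses-delete c false A x B)

  weight-mono-++ : ∀ c A {P P′} → P ⊆ P′ → weight c (A ++ P) ≤ weight c (A ++ P′)
  weight-mono-++ c A []                    = ≤-refl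
  weight-mono-++ c A {P} {y ∷ P′} (y ∷ʳ P⊆) = ≤-trans (weight-mono-++ c A P⊆) (weight-delete c A y P′)
  weight-mono-++ c A {y ∷ P} {y ∷ P′} (refl ∷ P⊆)
    rewrite sym (++-assoc A (y ∷ []) P) | sym (++-assoc A (y ∷ []) P′) = weight-mono-++ c (A ++ y ∷ []) P⊆

  weight-mono : ∀ c {P P′} → P ⊆ P′ → weight c P ≤ weight c P′
  weight-mono c = weight-mono-++ c []

module ODepthFormula (d : ℕ) (v : List ℕ) (mirror∈ : ∀ {k} → InRange d k → k ∉ v → star d k ∈ v) where

  open StarArithmetic d
  open Annotation d v

  inRangeᵇ-true : ∀ {k} → InRange d k → inRangeᵇ d k ≡ true
  inRangeᵇ-true {k} (1≤k , k≤2d) = cong₂ _∧_ (dec-true (0 <? k) 1≤k) (dec-true (k <? suc (2 * d)) (s≤s k≤2d))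

  inNᵇ-ph⇒star< : ∀ β → inNᵇ d v (ph d β) ≡ true → star d (proj₁ β) < proj₁ β
  inNᵇ-ph⇒star< (r , _) inN =
    <ᵇ⇒< (star d r) r (Equivalence.from T-≡
      (last-conjunct (inRangeᵇ d r) (inRangeᵇ d (star d r)) (not (does (r ∈? v))) (does (star d r ∈? v)) _ inN))
    where
    last-conjunct : ∀ a b c e f → a ∧ (b ∧ (c ∧ (e ∧ f))) ≡ true → f ≡ true
    last-conjunct a b c e f eq = ∧-conicalʳ e f (∧-conicalʳ c _ (∧-conicalʳ b _ (∧-conicalʳ a _ eq)))

  star<⇒inNᵇ-ph : ∀ {β} → InON d v β → star d (proj₁ β) < proj₁ β → inNᵇ d v (ph d β) ≡ true
  star<⇒inNᵇ-ph {r , _} (((r∈ , _ , r∉v , _) , _) , _) r*<r =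
    cong₂ _∧_ (inRangeᵇ-true r∈) (cong₂ _∧_ (inRangeᵇ-true (star-InRange r∈))
      (cong₂ _∧_ (cong not (dec-false (r ∈? v) r∉v))
        (cong₂ _∧_ (dec-true (star d r ∈? v) (mirror∈ r∈ r∉v)) (dec-true (star d r <? r) r*<r))))

  -- For β in ON_v, p_h(β) ∉ N_v exactly when β is low.
  Low : Pos → Set
  Low (r , _) = r ≤ star d r

  Low-downward : ∀ β β′ → proj₁ β′ < proj₁ β → Low β → Low β′
  Low-downward _ _ r′<r r≤r* = ≤-trans (<⇒≤ r′<r) (≤-trans r≤r* (star-antitone (<⇒≤ r′<r)))

  Low⇒oddEndType≡S : ∀ β → Low β → oddEndType β ≡ S
  Low⇒oddEndType≡S β low with inNᵇ d v (ph d β) in inN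
  ... | true  = contradiction low (<⇒≱ (inNᵇ-ph⇒star< β inN))
  ... | false = refl

  endType≡S⇒Low : ∀ e β → InON d v β → endType e β ≡ S → Low β
  endType≡S⇒Low true  _ _   ()
  endType≡S⇒Low false β onβ typeS with inNᵇ d v (ph d β) in inN
  ... | false = ≮⇒≥ λ r*<r → contradiction (trans (sym inN) (star<⇒inNᵇ-ph onβ r*<r)) λ ()
  endType≡S⇒Low false β onβ () | true

  Low⇒scanFrom≡S : ∀ {y ys} → Low y → Linked _≻_ (y ∷ ys) → scanFrom false y ys ≡ (y , S) ∷ scan false ys
  Low⇒scanFrom≡S {y} {[]}      low _ = cong (λ τ → (y , τ) ∷ []) (Low⇒oddEndType≡S y low)
  Low⇒scanFrom≡S {y} {y₂ ∷ ys} low ((r₂<r , _) ∷ _) with connᵇ d y y₂ in conn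
  ... | true  = contradiction low (<⇒≱ (<-trans (proj₂ (connᵇ≡true⇒Connected y y₂ conn)) r₂<r))
  ... | false = cong (λ τ → (y , τ) ∷ scanFrom false y₂ ys) (Low⇒oddEndType≡S y low)

  scanFrom-head : ∀ e x xs → ∃₂ λ τ e′ → scanFrom e x xs ≡ (x , τ) ∷ scan e′ xs
  scanFrom-head e x []       = endType e x , false , refl
  scanFrom-head e x (y ∷ ys) with connᵇ d x y
  ... | true  = V , not e , refl
  ... | false = endType e x , false , refl

  map-scanFrom : ∀ e x xs → map proj₁ (scanFrom e x xs) ≡ x ∷ xs
  map-scanFrom e x []       = refl
  map-scanFrom e x (y ∷ ys) with connᵇ d x y
  ... | true  = cong (x ∷_) (map-scanFrom (not e) y ys)
  ... | false = cong (x ∷_) (map-scanFrom false y ys)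

  map-scan : ∀ e xs → map proj₁ (scan e xs) ≡ xs
  map-scan e []       = refl
  map-scan e (x ∷ xs) = map-scanFrom e x xs

  ConsecutiveTypes : Rel (Pos × Ty) 0ℓ
  ConsecutiveTypes (β , τ) (β′ , τ′) = (τ ≢ V → connᵇ d β β′ ≡ false) × (τ ≡ S → τ′ ≡ S)

  scanFrom-ConsecutiveTypes : ∀ e x xs → All (InON d v) (x ∷ xs) → Linked _≻_ (x ∷ xs) →
    Linked ConsecutiveTypes (scanFrom e x xs)
  scanFrom-ConsecutiveTypes e x [] _ _ = [-]
  scanFrom-ConsecutiveTypes e x (y ∷ ys) (onx ∷ ony) (x≻y ∷ lnk) with connᵇ d x y in conn
  ... | true with scanFrom-head (not e) y ys | scanFrom-ConsecutiveTypes (not e) y ys ony lnk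
  ...   | _ , _ , head≡ | rest rewrite head≡ = ((λ V≢V → contradiction refl V≢V) , λ ()) ∷ rest
  scanFrom-ConsecutiveTypes e x (y ∷ ys) (onx ∷ ony) (x≻y ∷ lnk) | false
    with scanFrom-head false y ys | scanFrom-ConsecutiveTypes false y ys ony lnk
  ...   | τ , _ , head≡ | rest rewrite head≡ = ((λ _ → conn) , S-propagates) ∷ rest
    where
    S-propagates : endType e x ≡ S → τ ≡ S
    S-propagates typeS =
      let y-low = Low-downward x y (proj₁ x≻y) (endType≡S⇒Low e x onx typeS)
      in cong proj₂ (∷-injectiveˡ (trans (sym head≡) (Low⇒scanFrom≡S y-low lnk)))

  scan-ConsecutiveTypes : ∀ e xs → All (InON d v) xs → Linked _≻_ xs → Linked ConsecutiveTypes (scan e xs)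
  scan-ConsecutiveTypes e []       _ _ = []
  scan-ConsecutiveTypes e (x ∷ xs) ons lnk = scanFrom-ConsecutiveTypes e x xs ons lnk

  scanFrom-S⇒Low : ∀ e x xs → All (InON d v) (x ∷ xs) → All (λ (β , τ) → τ ≡ S → Low β) (scanFrom e x xs)
  scanFrom-S⇒Low e x []       (onx ∷ _)  = endType≡S⇒Low e x onx ∷ []
  scanFrom-S⇒Low e x (y ∷ ys) (onx ∷ ons) with connᵇ d x y
  ... | true  = (λ ()) ∷ scanFrom-S⇒Low (not e) y ys ons
  ... | false = endType≡S⇒Low e x onx ∷ scanFrom-S⇒Low false y ys ons

  scan-S⇒Low : ∀ e xs → All (InON d v) xs → All (λ (β , τ) → τ ≡ S → Low β) (scan e xs)
  scan-S⇒Low e []       _  = []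
  scan-S⇒Low e (x ∷ xs) ons = scanFrom-S⇒Low e x xs ons

  -- Annotating P ++ x ∷ X can change the annotation of P only at its last entry z, which may become V
  -- when z is connected to x.
  scanFrom-++-∷ : ∀ e p P x X → Σ (List (Pos × Ty)) λ A → Σ Pos λ z → ∃₂ λ τ₀ τ₁ → Σ Bool λ e′ →
    scanFrom e p (P ++ x ∷ X) ≡ A ++ (z , τ₀) ∷ scanFrom e′ x X ×
    scanFrom e p P ≡ A ++ (z , τ₁) ∷ [] ×
    (τ₀ ≡ τ₁ ⊎ (τ₀ ≡ V × connᵇ d z x ≡ true))
  scanFrom-++-∷ e p [] x X with connᵇ d p x in conn
  ... | true  = [] , p , V , endType e p , not e , refl , refl , inj₂ (refl , conn)
  ... | false = [] , p , endType e p , endType e p , false , refl , refl , inj₁ refl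
  scanFrom-++-∷ e p (p′ ∷ P) x X with connᵇ d p p′
  ... | true =
    let A , z , τ₀ , τ₁ , e′ , eq₀ , eq₁ , last = scanFrom-++-∷ (not e) p′ P x X
    in (p , V) ∷ A , z , τ₀ , τ₁ , e′ , cong ((p , V) ∷_) eq₀ , cong ((p , V) ∷_) eq₁ , last
  ... | false =
    let A , z , τ₀ , τ₁ , e′ , eq₀ , eq₁ , last = scanFrom-++-∷ false p′ P x X
        p-entry = (p , endType e p)
    in p-entry ∷ A , z , τ₀ , τ₁ , e′ , cong (p-entry ∷_) eq₀ , cong (p-entry ∷_) eq₁ , last

  hBonuses-cong-last : ∀ c A {a b} → hBonus c a ≡ hBonus c b → hBonuses c (A ++ a ∷ []) ≡ hBonuses c (A ++ b ∷ [])
  hBonuses-cong-last c []      eq = cong (_+ 0) eq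
  hBonuses-cong-last c (a ∷ A) eq = cong (hBonus c a +_) (hBonuses-cong-last c A eq)

  Connected⇒hBonus≡0 : ∀ z α τ → proj₂ α ≤ N → Connected z α → hBonus (proj₂ α) (z , τ) ≡ 0
  Connected⇒hBonus≡0 z α V _ _ = refl
  Connected⇒hBonus≡0 z α S _ _ = refl
  Connected⇒hBonus≡0 (r , _) (_ , c) H c≤N (r≤c* , _)
    with star d r <ᵇ c | <ᵇ-reflects-< (star d r) c
  ... | false | _         = refl
  ... | true  | ofʸ r*<c  =
    contradiction r*<c (≤⇒≯ (+≤N⇒≤star (subst (_≤ N) (+-comm r c) (≤star⇒+≤N c≤N r≤c*))))

  record AnnotationSplit (P : List Pos) (α : Pos) (R : List Pos) : Set where
    field
      AP          : List (Pos × Ty)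
      τ           : Ty
      AR          : List (Pos × Ty)
      scan≡       : scan false (P ++ α ∷ R) ≡ AP ++ (α , τ) ∷ AR
      map-AP      : map proj₁ AP ≡ P
      map-AR      : map proj₁ AR ≡ R
      hBonuses-AP : hBonuses (proj₂ α) AP ≡ hBonuses (proj₂ α) (scan false P)

  annotationSplit : ∀ P α R → proj₂ α ≤ N → AnnotationSplit P α R
  annotationSplit [] α R _ =
    let τ , e′ , head≡ = scanFrom-head false α R
    in record { AP = [] ; τ = τ ; AR = scan e′ R ; scan≡ = head≡
              ; map-AP = refl ; map-AR = map-scan e′ R ; hBonuses-AP = refl }
  annotationSplit (p ∷ P) α R c≤N =
    let A , z , τ₀ , τ₁ , e′ , eq₀ , eq₁ , last = scanFrom-++-∷ false p P α R
        τ , e″ , head≡ = scanFrom-head e′ α R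
    in record
      { AP = A ++ (z , τ₀) ∷ []
      ; τ = τ
      ; AR = scan e″ R
      ; scan≡ = trans eq₀ (trans (cong (λ as → A ++ (z , τ₀) ∷ as) head≡) (sym (++-assoc A ((z , τ₀) ∷ []) _)))
      ; map-AP = begin
          map proj₁ (A ++ (z , τ₀) ∷ [])  ≡⟨ map-++ proj₁ A _ ⟩
          map proj₁ A ++ z ∷ []           ≡⟨ sym (map-++ proj₁ A ((z , τ₁) ∷ [])) ⟩
          map proj₁ (A ++ (z , τ₁) ∷ [])  ≡⟨ cong (map proj₁) eq₁ ⟨
          map proj₁ (scanFrom false p P)  ≡⟨ map-scanFrom false p P ⟩
          p ∷ P                           ∎
      ; map-AR = map-scan e″ R
      ; hBonuses-AP = trans (hBonuses-cong-last (proj₂ α) A (lastBonus last)) (cong (hBonuses (proj₂ α)) (sym eq₁))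
      }
    where
    open ≡-Reasoning
    lastBonus : ∀ {z τ₀ τ₁} → τ₀ ≡ τ₁ ⊎ (τ₀ ≡ V × connᵇ d z α ≡ true) →
      hBonus (proj₂ α) (z , τ₀) ≡ hBonus (proj₂ α) (z , τ₁)
    lastBonus (inj₁ refl)           = refl
    lastBonus {z} {τ₁ = τ₁} (inj₂ (refl , conn)) =
      sym (Connected⇒hBonus≡0 z α τ₁ c≤N (connᵇ≡true⇒Connected z α conn))

  q : Pos × Ty → Pos
  q (β , τ) = qα d β τ

  -- For β above and left of an element of column c, leftPart c (β , τ) lists the elements of S_{C,β}
  -- lying strictly left of column c, in descending order.
  leftPart : ℕ → Pos × Ty → List Pos
  leftPart c (β , V) = pv d β ∷ []
  leftPart c (β , H) = pv d β ∷ (if star d (proj₁ β) <ᵇ c then ph d β ∷ [] else [])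
  leftPart c (β , S) = β ∷ []

  lastOfLeftPart : ℕ → Pos × Ty → Pos
  lastOfLeftPart c (β , V) = pv d β
  lastOfLeftPart c (β , H) = if star d (proj₁ β) <ᵇ c then ph d β else pv d β
  lastOfLeftPart c (β , S) = β

  Precedes : ℕ → Rel (Pos × Ty) 0ℓ
  Precedes c a b = lastOfLeftPart c a ≻ q b

  leftChain : ℕ → List (Pos × Ty) → Pos × Ty → List Pos
  leftChain c AP a = concatMap (leftPart c) AP ++ q a ∷ []

  pv≻q : ∀ {c r′ c′} τ′ → ONBounds r′ c′ → c < c′ → (star d c , c) ≻ q ((r′ , c′) , τ′)
  pv≻q V b′ c<c′ = ∸-monoʳ-< c<c′ (≤2d⇒≤N (ONBounds.c≤2d b′)) , c<c′
  pv≻q H b′ c<c′ = ∸-monoʳ-< c<c′ (≤2d⇒≤N (ONBounds.c≤2d b′)) , c<c′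
  pv≻q {r′ = r′} S b′ c<c′ = +<N⇒<star (<-trans (+-monoʳ-< r′ c<c′) (ONBounds.r+c<N b′)) , c<c′

  ph≻q : ∀ {r r′ c′} τ′ → c′ ≤ N → r′ < r → star d r < c′ → (r , star d r) ≻ q ((r′ , c′) , τ′)
  ph≻q {r} {c′ = c′} V c′≤N _ r*<c′ = N<+⇒star< c′≤N (subst (N <_) (+-comm r c′) (star<⇒N<+ r*<c′)) , r*<c′
  ph≻q {r} {c′ = c′} H c′≤N _ r*<c′ = N<+⇒star< c′≤N (subst (N <_) (+-comm r c′) (star<⇒N<+ r*<c′)) , r*<c′
  ph≻q S _ r′<r r*<c′ = r′<r , r*<c′

  pv≻ph : ∀ {r c} → ONBounds r c → (star d c , c) ≻ (r , star d r)
  pv≻ph b = +<N⇒<star (ONBounds.r+c<N b) , c<star-r b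

  consecutive⇒Precedes : ∀ {r c r′ c′ rα cα} τ τ′ → ONBounds r c → ONBounds r′ c′ → ONBounds rα cα →
    r′ < r → c < c′ → rα ≤ r′ → c′ ≤ cα →
    ConsecutiveTypes ((r , c) , τ) ((r′ , c′) , τ′) → Precedes cα ((r , c) , τ) ((r′ , c′) , τ′)
  consecutive⇒Precedes V τ′ _ b′ _ _ c<c′ _ _ _ = pv≻q τ′ b′ c<c′
  consecutive⇒Precedes {r} {c} {r′} {c′} {rα} {cα} H τ′ b b′ bα r′<r c<c′ rα≤r′ _ (notConnected , _)
    with star d r <ᵇ cα | <ᵇ-reflects-< (star d r) cα
  ... | false | _         = pv≻q τ′ b′ c<c′
  ... | true  | ofʸ r*<cα = ph≻q τ′ (≤2d⇒≤N (ONBounds.c≤2d b′)) r′<r r*<c′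
    where
    r*<c′ : star d r < c′
    r*<c′ with r ≤? star d c′
    ... | yes r≤c′* = contradiction (r≤c′* , <-trans r*<cα (<-≤-trans (ONBounds.c<r bα) rα≤r′))
                                    (connᵇ≡false⇒¬Connected (r , c) (r′ , c′) (notConnected λ ()))
    ... | no r≰c′*  = N<+⇒star< (≤2d⇒≤N (ONBounds.r≤2d b)) (≰⇒> (λ r+c′≤N → r≰c′* (+≤N⇒≤star r+c′≤N)))
  consecutive⇒Precedes S τ′ _ _ _ r′<r c<c′ _ _ (_ , S-propagates) with S-propagates refl
  ... | refl = r′<r , c<c′

  WeaklyAbove : Pos → Pos → Set
  WeaklyAbove (r , c) (rα , cα) = rα ≤ r × c ≤ cα

  consecutive⇒Precedes-linked : ∀ α → InON d v α → ∀ W → Linked ConsecutiveTypes W → Linked (_≻_ on proj₁) W →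
    All (λ e → InON d v (proj₁ e) × WeaklyAbove (proj₁ e) α) W → Linked (Precedes (proj₂ α)) W
  consecutive⇒Precedes-linked α onα []           _ _ _ = []
  consecutive⇒Precedes-linked α onα (_ ∷ [])     _ _ _ = [-]
  consecutive⇒Precedes-linked α onα (a ∷ b ∷ W) (types ∷ typesW) ((r′<r , c<c′) ∷ lnk)
                              ((ona , _) ∷ (onb , rα≤r′ , c′≤cα) ∷ rest) =
    consecutive⇒Precedes (proj₂ a) (proj₂ b) (InON⇒ONBounds ona) (InON⇒ONBounds onb) (InON⇒ONBounds onα)
      r′<r c<c′ rα≤r′ c′≤cα types
    ∷ consecutive⇒Precedes-linked α onα (b ∷ W) typesW lnk ((onb , rα≤r′ , c′≤cα) ∷ rest)

  leftPart-++ : ∀ c b {y ys} → InON d v (proj₁ b) → lastOfLeftPart c b ≻ y → Linked _≻_ (y ∷ ys) →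
    Linked _≻_ (leftPart c b ++ y ∷ ys)
  leftPart-++ c (β , V) _ ≻y lnk = ≻y ∷ lnk
  leftPart-++ c (β , S) _ ≻y lnk = ≻y ∷ lnk
  leftPart-++ c (β , H) onβ ≻y lnk with star d (proj₁ β) <ᵇ c
  ... | true  = pv≻ph (InON⇒ONBounds onβ) ∷ ≻y ∷ lnk
  ... | false = ≻y ∷ lnk

  leftChain-∷-++ : ∀ c b AP a → leftChain c (b ∷ AP) a ≡ leftPart c b ++ leftChain c AP a
  leftChain-∷-++ c b AP a = ++-assoc (leftPart c b) (concatMap (leftPart c) AP) (q a ∷ [])

  leftChain-∷ : ∀ c b AP a → ∃ λ t → leftChain c (b ∷ AP) a ≡ q b ∷ t
  leftChain-∷ c (β , V) AP a = _ , refl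
  leftChain-∷ c (β , H) AP a = _ , refl
  leftChain-∷ c (β , S) AP a = _ , refl

  leftChain-descending : ∀ c AP a → Linked (Precedes c) (AP ++ a ∷ []) → All (λ e → InON d v (proj₁ e)) AP →
    Linked _≻_ (leftChain c AP a)
  leftChain-descending c [] a _ _ = [-]
  leftChain-descending c (b ∷ []) a (b≺a ∷ _) (onb ∷ _)
    rewrite leftChain-∷-++ c b [] a = leftPart-++ c b onb b≺a [-]
  leftChain-descending c (b ∷ b′ ∷ AP) a (b≺b′ ∷ lnk) (onb ∷ ons)
    with leftChain-∷ c b′ AP a | leftChain-descending c (b′ ∷ AP) a lnk ons
  ... | _ , starts-q | descending rewrite leftChain-∷-++ c b (b′ ∷ AP) a | starts-q =
    leftPart-++ c b onb b≺b′ descending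

  length-leftPart : ∀ c b → length (leftPart c b) ≡ suc (hBonus c b)
  length-leftPart c (β , V) = refl
  length-leftPart c (β , S) = refl
  length-leftPart c (β , H) with star d (proj₁ β) <ᵇ c
  ... | true  = refl
  ... | false = refl

  length-leftParts : ∀ c AP → length (concatMap (leftPart c) AP) ≡ length AP + hBonuses c AP
  length-leftParts c []       = refl
  length-leftParts c (b ∷ AP) = begin
    length (leftPart c b ++ concatMap (leftPart c) AP)
      ≡⟨ length-++ (leftPart c b) ⟩
    length (leftPart c b) + length (concatMap (leftPart c) AP)
      ≡⟨ cong₂ _+_ (length-leftPart c b) (length-leftParts c AP) ⟩
    suc (hBonus c b + (length AP + hBonuses c AP))
      ≡⟨ cong suc (x∙yz≈y∙xz +-commutativeSemigroup (hBonus c b) (length AP) _) ⟩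
    suc (length AP + (hBonus c b + hBonuses c AP))
      ∎
    where open ≡-Reasoning

  length-leftChain : ∀ c AP a → length (leftChain c AP a) ≡ length AP + hBonuses c AP + 1
  length-leftChain c AP a = trans (length-++ (concatMap (leftPart c) AP)) (cong (_+ 1) (length-leftParts c AP))

  ∈SC⁺ : ∀ C {e y} → e ∈ annotate d v C → y ∈ Sα d (proj₁ e) (proj₂ e) → y ∈ SC d v C
  ∈SC⁺ C e∈ y∈ = ∈-concatMap⁺ _ (lose e∈ y∈)

  ∈SC⁻ : ∀ C {y} → y ∈ SC d v C → ∃ λ e → e ∈ annotate d v C × y ∈ Sα d (proj₁ e) (proj₂ e)
  ∈SC⁻ C y∈ = find (∈-concatMap⁻ _ y∈)

  leftPart⊆Sα : ∀ c e {y} → y ∈ leftPart c e → y ∈ Sα d (proj₁ e) (proj₂ e)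
  leftPart⊆Sα c (β , V) (here refl) = here refl
  leftPart⊆Sα c (β , S) (here refl) = here refl
  leftPart⊆Sα c (β , H) y∈ with star d (proj₁ β) <ᵇ c | y∈
  ... | true  | here refl         = here refl
  ... | true  | there (here refl) = there (here refl)
  ... | false | here refl         = here refl

  q∈Sα : ∀ e → q e ∈ Sα d (proj₁ e) (proj₂ e)
  q∈Sα (β , V) = here refl
  q∈Sα (β , H) = here refl
  q∈Sα (β , S) = here refl

  column-q : ∀ e → proj₂ (q e) ≡ proj₂ (proj₁ e)
  column-q (β , V) = refl
  column-q (β , H) = refl
  column-q (β , S) = refl

  column≤Sα : ∀ β τ {y} → ONBounds (proj₁ β) (proj₂ β) → y ∈ Sα d β τ → proj₂ β ≤ proj₂ y
  column≤Sα β V b (here refl)         = ≤-refl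
  column≤Sα β H b (here refl)         = ≤-refl
  column≤Sα β S b (here refl)         = ≤-refl
  column≤Sα β H b (there (here refl)) = <⇒≤ (c<star-r b)
  column≤Sα β S b (there (here refl)) = <⇒≤ (c<star-r b)

  Sα-left⇒∈leftPart : ∀ {rα c} e {y} → ONBounds rα c → proj₁ e ≻ (rα , c) → (proj₂ e ≡ S → Low (proj₁ e)) →
    y ∈ Sα d (proj₁ e) (proj₂ e) → proj₂ y < c → y ∈ leftPart c e
  Sα-left⇒∈leftPart (β , V) _ _ _ (here refl) _ = here refl
  Sα-left⇒∈leftPart (β , H) _ _ _ (here refl) _ = here refl
  Sα-left⇒∈leftPart (β , S) _ _ _ (here refl) _ = here refl
  Sα-left⇒∈leftPart (β , S) bα (rα<r , _) low (there (here refl)) r*<c =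
    contradiction (<-trans r*<c (<-trans (ONBounds.c<r bα) rα<r)) (≤⇒≯ (low refl))
  Sα-left⇒∈leftPart {c = c} (β , H) _ _ _ (there (here refl)) r*<c
    with star d (proj₁ β) <ᵇ c | <ᵇ-reflects-< (star d (proj₁ β)) c
  ... | true  | _        = there (here refl)
  ... | false | ofⁿ r*≮c = contradiction r*<c r*≮c

  module _ (P : List Pos) (α : Pos) (R : List Pos) (chain : VChain d v (P ++ α ∷ R)) where

    private
      C = P ++ α ∷ R
      c = proj₂ α

      onα : InON d v α
      onα = All.lookup (proj₁ chain) (∈-++⁺ʳ P (here refl))

      open AnnotationSplit (annotationSplit P α R (≤2d⇒≤N (ONBounds.c≤2d (InON⇒ONBounds onα))))

      annotate≡ : annotate d v C ≡ AP ++ (α , τ) ∷ AR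
      annotate≡ = trans (annotate≡scan C) scan≡

      AP⊆annotate : ∀ {e} → e ∈ AP → e ∈ annotate d v C
      AP⊆annotate e∈ = subst (_ ∈_) (sym annotate≡) (∈-++⁺ˡ e∈)

      ∈P : ∀ {e} → e ∈ AP → proj₁ e ∈ P
      ∈P e∈ = subst (_ ∈_) map-AP (∈-map⁺ proj₁ e∈)

      ∈R : ∀ {e} → e ∈ AR → proj₁ e ∈ R
      ∈R e∈ = subst (_ ∈_) map-AR (∈-map⁺ proj₁ e∈)

      onP : ∀ {β} → β ∈ P → InON d v β
      onP β∈ = All.lookup (proj₁ chain) (∈-++⁺ˡ β∈)

      onR : ∀ {β} → β ∈ R → InON d v β
      onR β∈ = All.lookup (proj₁ chain) (∈-++⁺ʳ P (there β∈))

      aboveα : ∀ {β} → β ∈ P → β ≻ α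
      aboveα = All.lookup (above-middle P (proj₂ chain))

      belowα : ∀ {β} → β ∈ R → α ≻ β
      belowα = All.lookup (below-middle P (proj₂ chain))

      W : List (Pos × Ty)
      W = AP ++ (α , τ) ∷ []

      scan≡W++AR : scan false C ≡ W ++ AR
      scan≡W++AR = trans scan≡ (sym (++-assoc AP ((α , τ) ∷ []) AR))

      W-types : Linked ConsecutiveTypes W
      W-types = Linked-++⁻ˡ W (subst (Linked ConsecutiveTypes) scan≡W++AR
                                     (scan-ConsecutiveTypes false C (proj₁ chain) (proj₂ chain)))

      W-descending : Linked (_≻_ on proj₁) W
      W-descending = map⁻ (subst (Linked _≻_) map-W P++α-descending)
        where
        P++α-descending : Linked _≻_ (P ++ α ∷ [])
        P++α-descending = Linked-++⁻ˡ (P ++ α ∷ []) (subst (Linked _≻_) (sym (++-assoc P (α ∷ []) R)) (proj₂ chain))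

        map-W : P ++ α ∷ [] ≡ map proj₁ W
        map-W = sym (trans (map-++ proj₁ AP ((α , τ) ∷ [])) (cong (_++ α ∷ []) map-AP))

      W-weaklyAbove : All (λ e → InON d v (proj₁ e) × WeaklyAbove (proj₁ e) α) W
      W-weaklyAbove = All.tabulate λ e∈ → entry (∈-++⁻ AP e∈)
        where
        entry : ∀ {e} → e ∈ AP ⊎ e ∈ (α , τ) ∷ [] → InON d v (proj₁ e) × WeaklyAbove (proj₁ e) α
        entry (inj₁ e∈)          = onP (∈P e∈) , <⇒≤ (proj₁ (aboveα (∈P e∈))) , <⇒≤ (proj₂ (aboveα (∈P e∈)))
        entry (inj₂ (here refl)) = onα , ≤-refl , ≤-refl

      AP-S⇒Low : All (λ (β , τ) → τ ≡ S → Low β) AP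
      AP-S⇒Low = All.++⁻ˡ AP (subst (All _) scan≡ (scan-S⇒Low false C (proj₁ chain)))

      chainToQ : List Pos
      chainToQ = leftChain c AP (α , τ)

      chainToQ-descending : Linked _≻_ chainToQ
      chainToQ-descending = leftChain-descending c AP (α , τ)
        (consecutive⇒Precedes-linked α onα W W-types W-descending W-weaklyAbove)
        (All.tabulate λ e∈ → onP (∈P e∈))

      α∈annotate : (α , τ) ∈ annotate d v C
      α∈annotate = subst ((α , τ) ∈_) (sym annotate≡) (∈-++⁺ʳ AP (here refl))

      chainToQ⊆SC : All (_∈ SC d v C) chainToQ
      chainToQ⊆SC = All.tabulate λ y∈ → entry (∈-++⁻ (concatMap (leftPart c) AP) y∈)
        where
        entry : ∀ {y} → y ∈ concatMap (leftPart c) AP ⊎ y ∈ q (α , τ) ∷ [] → y ∈ SC d v C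
        entry (inj₁ y∈)          = let e , e∈ , y∈e = find (∈-concatMap⁻ (leftPart c) y∈)
                                   in ∈SC⁺ C (AP⊆annotate e∈) (leftPart⊆Sα c e y∈e)
        entry (inj₂ (here refl)) = ∈SC⁺ C α∈annotate (q∈Sα (α , τ))

      SC-above-q : ∀ {y} → y ∈ SC d v C → y ≻ q (α , τ) → y ∈ concatMap (leftPart c) AP
      SC-above-q {y} y∈ (_ , y-left) with ∈SC⁻ C y∈ | subst (proj₂ y <_) (column-q (α , τ)) y-left
      ... | e , e∈ , y∈e | y<c with ∈-++⁻ AP (subst (e ∈_) annotate≡ e∈)
      ...   | inj₁ e∈AP =
        ∈-concatMap⁺ (leftPart c) (lose e∈AP
          (Sα-left⇒∈leftPart e (InON⇒ONBounds onα) (aboveα (∈P e∈AP)) (All.lookup AP-S⇒Low e∈AP) y∈e y<c))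
      ...   | inj₂ (here refl) = contradiction (column≤Sα α τ (InON⇒ONBounds onα) y∈e) (<⇒≱ y<c)
      ...   | inj₂ (there e∈AR) =
        contradiction (column≤Sα (proj₁ e) (proj₂ e) (InON⇒ONBounds (onR (∈R e∈AR))) y∈e)
                      (<⇒≱ (<-trans y<c (proj₂ (belowα (∈R e∈AR)))))

    odepth≡weight+1 : ODepth d v (P ++ α ∷ R) α (weight (proj₂ α) P + 1)
    odepth≡weight+1 =
      τ , α∈annotate ,
      subst (Depth (SC d v C) (q (α , τ))) length≡
        (saturated-chain⇒Depth (concatMap (leftPart c) AP) chainToQ⊆SC chainToQ-descending SC-above-q)
      where
      length≡ : length chainToQ ≡ weight c P + 1
      length≡ = trans (length-leftChain c AP (α , τ))
        (cong (_+ 1) (cong₂ _+_ (trans (sym (length-map proj₁ AP)) (cong length map-AP)) hBonuses-AP))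

proposition6p1 : (d : ℕ) (v : List ℕ) → InI d v →
    ((C D : List Pos) → VChain d v C → VChain d v D → C ⊆ D →
      (α : Pos) → α ∈ C →
      Σ ℕ λ t₁ → Σ ℕ λ t₂ → ODepth d v C α t₁ × ODepth d v D α t₂ × t₁ ≤ t₂)
    ×
    ((C E : List Pos) → VChain d v (C ++ E) →
      (α : Pos) → α ∈ C →
      Σ ℕ λ t → ODepth d v C α t × ODepth d v (C ++ E) α t)
proposition6p1 d v (_ , _ , _ , complementary , _) = subchain , initialSegment
  where
  mirror∈ : ∀ {k} → InRange d k → k ∉ v → star d k ∈ v
  mirror∈ {k} k∈ k∉v with complementary k k∈
  ... | inj₁ (k∈v , _)  = contradiction k∈v k∉v
  ... | inj₂ (_ , k*∈v) = k*∈v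

  open Annotation d v using (weight; weight-mono)
  open ODepthFormula d v mirror∈ using (odepth≡weight+1)

  subchain : (C D : List Pos) → VChain d v C → VChain d v D → C ⊆ D → (α : Pos) → α ∈ C →
    Σ ℕ λ t₁ → Σ ℕ λ t₂ → ODepth d v C α t₁ × ODepth d v D α t₂ × t₁ ≤ t₂
  subchain C D chainC chainD C⊆D α α∈C with ∈-∃++ α∈C
  ... | P , R , refl with ⊆-middle P C⊆D
  ...   | P′ , R′ , refl , P⊆P′ =
    _ , _ , odepth≡weight+1 P α R chainC , odepth≡weight+1 P′ α R′ chainD ,
    +-monoˡ-≤ 1 (weight-mono (proj₂ α) P⊆P′)

  initialSegment : (C E : List Pos) → VChain d v (C ++ E) → (α : Pos) → α ∈ C →
    Σ ℕ λ t → ODepth d v C α t × ODepth d v (C ++ E) α t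
  initialSegment C E chainCE α α∈C with ∈-∃++ α∈C
  ... | P , R , refl =
    _ ,
    odepth≡weight+1 P α R (VChain-++⁻ˡ {d} {v} (P ++ α ∷ R) chainCE) ,
    subst (λ D → ODepth d v D α (weight (proj₂ α) P + 1)) (sym (++-assoc P (α ∷ R) E))
      (odepth≡weight+1 P α (R ++ E) (subst (VChain d v) (++-assoc P (α ∷ R) E) chainCE))
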